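{- Suppose that every strongly admissible multiset of the form $\{1^a,x^b,y^c\}$ with integers $1<x<y$, $a,b,c\ge 0$, and $a+b\ge y-1$ is realizable. Then every strongly admissible multiset $L$ with $|\mathrm{supp}(L)|=3$ is realizable.
   Context: For a positive integer $v$, $K_v$ is the complete graph on vertex set $\{0,1,\dots,v-1\}$; the length of an edge $\{u,w\}$ is $\min(|u-w|,\,v-|u-w|)$. A multiset $L$ of positive integers of size $v-1$ is realizable if there is a Hamiltonian path in $K_v$ whose multiset of edge lengths equals $L$. $\{x_1^{a_1},\dots,x_k^{a_k}\}$ denotes the multiset containing $x_i$ with multiplicity $a_i$, and $\mathrm{supp}(L)$ is the set of distinct elements of $L$. A multiset $L$ of size $v-1$ is strongly admissible if $\mathrm{supp}(L)\subseteq\{1,2,\dots,\lfloor v/2\rfloor\}$ and $\gcd(v,z)=1$ for every $z\in L$. -}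

module Defs where

open import Data.Nat using (ℕ; zero; suc; _+_; _∸_; _≤_; _<_; _⊓_; ∣_-_∣; _/_)
open import Data.Nat.GCD using (gcd)
open import Data.Nat.Properties using (_≟_)
open import Data.List using (List; []; _∷_; length; upTo; replicate; _++_; deduplicate)
open import Data.List.Relation.Unary.All using (All)
open import Data.List.Relation.Binary.Permutation.Propositional using (_↭_)
open import Data.Product using (Σ; _×_)
open import Relation.Binary.PropositionalEquality using (_≡_)

-- Multisets of naturals are represented as lists, compared up to permutation (_↭_).

edgeLength : ℕ → ℕ → ℕ → ℕ
edgeLength v u w = ∣ u - w ∣ ⊓ (v ∸ ∣ u - w ∣)

edgeLengths : ℕ → List ℕ → List ℕ
edgeLengths v [] = []
edgeLengths v (u ∷ []) = []
edgeLengths v (u ∷ w ∷ rest) = edgeLength v u w ∷ edgeLengths v (w ∷ rest)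

HamiltonianPath : ℕ → List ℕ → Set
HamiltonianPath v p = p ↭ upTo v

Realizable : List ℕ → Set
Realizable L = Σ (List ℕ) (λ p → HamiltonianPath (suc (length L)) p × edgeLengths (suc (length L)) p ↭ L)

StronglyAdmissible : List ℕ → Set
StronglyAdmissible L =
  All (λ z → 1 ≤ z × z ≤ suc (length L) / 2 × gcd (suc (length L)) z ≡ 1) L

supp : List ℕ → List ℕ
supp L = deduplicate _≟_ L

ms3 : ℕ → ℕ → ℕ → ℕ → ℕ → ℕ → List ℕ
ms3 x1 a x2 b x3 c = replicate a x1 ++ replicate b x2 ++ replicate c x3

{-# OPTIONS --safe #-}
-- Let x be a value of largest multiplicity in L. As gcd(v, x) = 1, i ↦ x i mod v permutes the
-- vertices of K_v and turns an edge of length d into one of length ℓ(x d), where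
-- ℓ t = min(t mod v, v − t mod v). Hence L is the image of a strongly admissible multiset
-- {1^a, y^b, z^c}, 1 < y < z, whose realizations map to realizations of L; and since a is the
-- largest multiplicity, 2z ≤ v = a + b + c + 1 ≤ 2a + b + 1 gives z − 1 ≤ a + b.
module Submission where

open import Defs
open import Data.Nat using (ℕ; zero; suc; _+_; _*_; _∸_; _≤_; _<_; _/_; _%_; ∣_-_∣; z≤n; s≤s)
open import Data.Nat.Properties
open import Data.Nat.DivMod
open import Data.Nat.Divisibility using (_∣_; _∣0; ∣1⇒≡1; ∣m+n∣m⇒∣n; ∣n⇒∣m*n; ∣n∣m%n⇒∣m; %-presˡ-∣)
open import Data.Nat.GCD using (gcd; gcd[m,n]∣n; module Bézout)
open import Data.Nat.Coprimality using (Coprime; coprime-Bézout; coprime⇒gcd≡1; gcd≡1⇒coprime)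
open import Data.Nat.Tactic.RingSolver using (solve-∀)
open import Data.Product using (Σ; _×_; _,_; ∃; ∃₂; proj₁; proj₂)
import Data.Product as Product
open import Data.Sum using (_⊎_; inj₁; inj₂; swap)
open import Data.List using (List; []; _∷_; length; map; replicate; _++_; upTo; applyUpTo)
open import Data.List.Properties using (length-++; length-replicate; map-++; map-replicate; map-upTo)
open import Data.List.Relation.Unary.All using (All; []; _∷_; lookup; tabulate)
open import Data.List.Relation.Unary.All.Properties using (all-upTo; ++⁺; replicate⁺)
open import Data.List.Relation.Unary.Any using (here; there)
open import Data.List.Relation.Unary.AllPairs using ([]; _∷_)
open import Data.List.Relation.Unary.Unique.Propositional using (Unique)
open import Data.List.Relation.Unary.Unique.Propositional.Properties using (upTo⁺; applyUpTo⁺₁)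
open import Data.List.Relation.Unary.Unique.DecPropositional.Properties _≟_ using (deduplicate-!)
open import Data.List.Membership.Propositional using (_∈_)
open import Data.List.Membership.Propositional.Properties
  using (∈-deduplicate⁺; ∈-deduplicate⁻; ∈-applyUpTo⁺; ∈-applyUpTo⁻; ∈-upTo⁺; ∈-upTo⁻)
open import Data.List.Membership.Propositional.Properties.WithK using (unique∧set⇒bag)
open import Data.List.Relation.Binary.BagAndSetEquality using (∼bag⇒↭)
open import Data.List.Relation.Binary.Permutation.Propositional
  using (_↭_; ↭-refl; ↭-sym; ↭-trans; ↭-reflexive; prep)
open import Data.List.Relation.Binary.Permutation.Propositional.Properties
  using (map⁺; All-resp-↭; ↭-length; shift; shifts; ++-comm; ++⁺ˡ)
open import Function using (_∘_)
open import Function.Bundles using (mk⇔)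
open import Relation.Binary.Bundles using (Setoid)
open import Relation.Binary.Definitions using (tri<; tri≈; tri>)
open import Relation.Binary.PropositionalEquality
open import Relation.Nullary using (yes; no; contradiction)

Admissible : ℕ → ℕ → Set
Admissible v z = 1 ≤ z × z ≤ v / 2 × gcd v z ≡ 1

z+z≡z*2 : ∀ z → z + z ≡ z * 2
z+z≡z*2 z = trans (cong (z +_) (sym (+-identityʳ z))) (*-comm 2 z)

≤/2⇒double≤ : ∀ {z v} → z ≤ v / 2 → z + z ≤ v
≤/2⇒double≤ {z} {v} z≤v/2 = begin
  z + z      ≡⟨ z+z≡z*2 z ⟩
  z * 2      ≤⟨ *-monoˡ-≤ 2 z≤v/2 ⟩
  v / 2 * 2  ≤⟨ m/n*n≤m v 2 ⟩
  v          ∎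
  where open ≤-Reasoning

double≤⇒≤/2 : ∀ {z v} → z + z ≤ v → z ≤ v / 2
double≤⇒≤/2 {z} {v} z+z≤v = begin
  z          ≡⟨ m*n/n≡m z 2 ⟨
  z * 2 / 2  ≤⟨ /-monoˡ-≤ 2 (subst (_≤ v) (z+z≡z*2 z) z+z≤v) ⟩
  v / 2      ∎
  where open ≤-Reasoning

Admissible-1 : ∀ {v} → 1 ≤ v / 2 → Admissible v 1
Admissible-1 {v} 1≤v/2 = ≤-refl , 1≤v/2 , ∣1⇒≡1 (gcd[m,n]∣n v 1)

m+m≤1+n+n⇒m≤n : ∀ {m n} → m + m ≤ suc (n + n) → m ≤ n
m+m≤1+n+n⇒m≤n {m} {n} m+m≤1+n+n with m ≤? n
... | yes m≤n = m≤n
... | no  m≰n = contradiction (subst (_≤ suc (n + n)) (cong suc (+-suc n n)) 2+n+n≤1+n+n) 1+n≰n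
  where 2+n+n≤1+n+n = ≤-trans (+-mono-≤ (≰⇒> m≰n) (≰⇒> m≰n)) m+m≤1+n+n

y∸1≤a+b : ∀ {a b c y} → c ≤ a → y + y ≤ suc (a + (b + c)) → y ∸ 1 ≤ a + b
y∸1≤a+b {a} {b} {c} {y} c≤a y+y≤v = ≤-trans (m∸n≤m y 1) (m+m≤1+n+n⇒m≤n (begin
  y + y                  ≤⟨ y+y≤v ⟩
  suc (a + (b + c))      ≡⟨ cong suc (+-assoc a b c) ⟨
  suc (a + b + c)        ≤⟨ s≤s (+-monoʳ-≤ (a + b) (≤-trans c≤a (m≤m+n a b))) ⟩
  suc (a + b + (a + b))  ∎))
  where open ≤-Reasoning

RealizableOn : ℕ → List ℕ → Set
RealizableOn v L = Σ (List ℕ) (λ p → HamiltonianPath v p × edgeLengths v p ↭ L)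

module Modular (n : ℕ) where

  v : ℕ
  v = suc n

  private variable a b c d e i j t : ℕ

  -- Congruence modulo v, wrapped in a record so that both sides can be inferred.
  infix 4 _≈_
  record _≈_ (a b : ℕ) : Set where
    constructor mk≈
    field %≡% : a % v ≡ b % v
  open _≈_ public

  ≈-setoid : Setoid _ _
  ≈-setoid = record
    { Carrier       = ℕ
    ; _≈_           = _≈_
    ; isEquivalence = record
      { refl  = mk≈ refl
      ; sym   = λ a≈b → mk≈ (sym (%≡% a≈b))
      ; trans = λ a≈b b≈c → mk≈ (trans (%≡% a≈b) (%≡% b≈c))
      }
    }

  open Setoid ≈-setoid public using () renaming (refl to ≈-refl; sym to ≈-sym; trans to ≈-trans; reflexive to ≈-reflexive)

  %-≈ : ∀ a → a % v ≈ a
  %-≈ a = mk≈ (m%n%n≡m%n a v)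

  +-cong : a ≈ b → c ≈ d → a + c ≈ b + d
  +-cong {a} {b} {c} {d} (mk≈ a≈b) (mk≈ c≈d) = mk≈ (begin
    (a + c) % v            ≡⟨ %-distribˡ-+ a c v ⟩
    (a % v + c % v) % v    ≡⟨ cong₂ (λ x y → (x + y) % v) a≈b c≈d ⟩
    (b % v + d % v) % v    ≡⟨ %-distribˡ-+ b d v ⟨
    (b + d) % v            ∎)
    where open ≡-Reasoning

  *-cong : a ≈ b → c ≈ d → a * c ≈ b * d
  *-cong {a} {b} {c} {d} (mk≈ a≈b) (mk≈ c≈d) = mk≈ (begin
    (a * c) % v            ≡⟨ %-distribˡ-* a c v ⟩
    (a % v * (c % v)) % v  ≡⟨ cong₂ (λ x y → (x * y) % v) a≈b c≈d ⟩
    (b % v * (d % v)) % v  ≡⟨ %-distribˡ-* b d v ⟨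
    (b * d) % v            ∎)
    where open ≡-Reasoning

  *-congˡ : ∀ w → a ≈ b → w * a ≈ w * b
  *-congˡ w = *-cong {w} {w} (mk≈ refl)

  open import Relation.Binary.Reasoning.Setoid ≈-setoid

  v≈0 : v ≈ 0
  v≈0 = mk≈ (n%n≡0 v)

  +-inverseˡ : ∀ c → (v ∸ c % v) + c ≈ 0
  +-inverseˡ c = begin
    v ∸ c % v + c      ≈⟨ +-cong ≈-refl (%-≈ c) ⟨
    v ∸ c % v + c % v  ≡⟨ m∸n+n≡m (m%n≤n c v) ⟩
    v                  ≈⟨ v≈0 ⟩
    0                  ∎

  +-cancelˡ : c + a ≈ c + b → a ≈ b
  +-cancelˡ {c} {a} {b} c+a≈c+b = begin
    a                ≈⟨ +-cong (+-inverseˡ c) ≈-refl ⟨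
    c′ + c + a       ≡⟨ +-assoc c′ c a ⟩
    c′ + (c + a)     ≈⟨ +-cong (≈-refl {c′}) c+a≈c+b ⟩
    c′ + (c + b)     ≡⟨ +-assoc c′ c b ⟨
    c′ + c + b       ≈⟨ +-cong (+-inverseˡ c) ≈-refl ⟩
    b                ∎
    where c′ = v ∸ c % v

  ≈⇒≡ : a < v → b < v → a ≈ b → a ≡ b
  ≈⇒≡ a<v b<v (mk≈ a≈b) = trans (sym (m<n⇒m%n≡m a<v)) (trans a≈b (m<n⇒m%n≡m b<v))

  double≤⇒< : d + d ≤ v → d < v
  double≤⇒< {zero}  _           = s≤s z≤n
  double≤⇒< {suc d} (s≤s d+d<v) = s≤s (≤-trans (m≤n+m (suc d) d) d+d<v)

  -- d ≡ −e (mod v) with d, e ≤ v / 2 leaves only d = e = 0 and d = e = v / 2.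
  +≈0⇒≡ : d + d ≤ v → e + e ≤ v → d + e ≈ 0 → d ≡ e
  +≈0⇒≡ {d} {e} dd ee d+e≈0 with m≤n⇒m<n∨m≡n d+e≤v
    where
      d+e≤v : d + e ≤ v
      d+e≤v with ≤-total d e
      ... | inj₁ d≤e = ≤-trans (+-monoˡ-≤ e d≤e) ee
      ... | inj₂ e≤d = ≤-trans (+-monoʳ-≤ d e≤d) dd
  ... | inj₁ d+e<v = trans (m+n≡0⇒m≡0 d d+e≡0) (sym (m+n≡0⇒n≡0 d d+e≡0))
    where d+e≡0 = ≈⇒≡ d+e<v (s≤s z≤n) d+e≈0
  ... | inj₂ d+e≡v = ≤-antisym (+-cancelˡ-≤ d d e (≤-trans dd (≤-reflexive (sym d+e≡v))))
                               (+-cancelʳ-≤ e e d (≤-trans ee (≤-reflexive (sym d+e≡v))))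

  Differ : ℕ → ℕ → ℕ → Set
  Differ d i j = i + d ≈ j ⊎ j + d ≈ i

  Differ-sym : Differ d i j → Differ d j i
  Differ-sym = swap

  Differ-resp-≈ : ∀ {i′ j′} → i ≈ i′ → j ≈ j′ → Differ d i j → Differ d i′ j′
  Differ-resp-≈ i≈i′ j≈j′ (inj₁ i+d≈j) = inj₁ (≈-trans (+-cong (≈-sym i≈i′) ≈-refl) (≈-trans i+d≈j j≈j′))
  Differ-resp-≈ i≈i′ j≈j′ (inj₂ j+d≈i) = inj₂ (≈-trans (+-cong (≈-sym j≈j′) ≈-refl) (≈-trans j+d≈i i≈i′))

  Differ-*ˡ : ∀ w → Differ d i j → Differ (w * d) (w * i) (w * j)
  Differ-*ˡ {d} {i} {j} w (inj₁ i+d≈j) =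
    inj₁ (≈-trans (≈-reflexive (sym (*-distribˡ-+ w i d))) (*-congˡ w i+d≈j))
  Differ-*ˡ {d} {i} {j} w (inj₂ j+d≈i) =
    inj₂ (≈-trans (≈-reflexive (sym (*-distribˡ-+ w j d))) (*-congˡ w j+d≈i))

  +-inverse-shift : d + e ≈ 0 → i + d ≈ j → j + e ≈ i
  +-inverse-shift {d} {e} {i} {j} d+e≈0 i+d≈j = begin
    j + e          ≈⟨ +-cong i+d≈j ≈-refl ⟨
    i + d + e      ≡⟨ +-assoc i d e ⟩
    i + (d + e)    ≈⟨ +-cong (≈-refl {i}) d+e≈0 ⟩
    i + 0          ≡⟨ +-identityʳ i ⟩
    i              ∎

  Differ-resp-± : Differ d i j → Differ e d 0 → Differ e i j
  Differ-resp-± (inj₁ i+d≈j) (inj₂ e≈d) = inj₁ (≈-trans (+-cong ≈-refl e≈d) i+d≈j)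
  Differ-resp-± (inj₂ j+d≈i) (inj₂ e≈d) = inj₂ (≈-trans (+-cong ≈-refl e≈d) j+d≈i)
  Differ-resp-± (inj₁ i+d≈j) (inj₁ d+e≈0) = inj₂ (+-inverse-shift d+e≈0 i+d≈j)
  Differ-resp-± (inj₂ j+d≈i) (inj₁ d+e≈0) = inj₁ (+-inverse-shift d+e≈0 j+d≈i)

  Differ-unique : d + d ≤ v → e + e ≤ v → Differ d i j → Differ e i j → d ≡ e
  Differ-unique dd ee (inj₁ i+d≈j) (inj₁ i+e≈j) =
    ≈⇒≡ (double≤⇒< dd) (double≤⇒< ee) (+-cancelˡ (≈-trans i+d≈j (≈-sym i+e≈j)))
  Differ-unique dd ee (inj₂ j+d≈i) (inj₂ j+e≈i) =
    ≈⇒≡ (double≤⇒< dd) (double≤⇒< ee) (+-cancelˡ (≈-trans j+d≈i (≈-sym j+e≈i)))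
  Differ-unique {d} {e} {i} dd ee (inj₁ i+d≈j) (inj₂ j+e≈i) =
    +≈0⇒≡ dd ee (+-cancelˡ (begin
      i + (d + e)  ≡⟨ +-assoc i d e ⟨
      i + d + e    ≈⟨ +-cong i+d≈j ≈-refl ⟩
      _            ≈⟨ j+e≈i ⟩
      i            ≡⟨ +-identityʳ i ⟨
      i + 0        ∎))
  Differ-unique dd ee (inj₂ j+d≈i) (inj₁ i+e≈j) =
    sym (Differ-unique ee dd (inj₁ i+e≈j) (inj₂ j+d≈i))

  +≡⇒Differ : i + d ≡ j → d ≤ v → Differ d i j × Differ (v ∸ d) i j
  +≡⇒Differ {i} {d} refl d≤v = inj₁ ≈-refl , inj₂ (begin
    i + d + (v ∸ d)    ≡⟨ +-assoc i d (v ∸ d) ⟩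
    i + (d + (v ∸ d))  ≡⟨ cong (i +_) (m+[n∸m]≡n d≤v) ⟩
    i + v              ≈⟨ +-cong (≈-refl {i}) v≈0 ⟩
    i + 0              ≡⟨ +-identityʳ i ⟩
    i                  ∎)

  distance-Differ : i < v → j < v → Differ ∣ i - j ∣ i j × Differ (v ∸ ∣ i - j ∣) i j
  distance-Differ {i} {j} i<v j<v with ≤-total i j
  ... | inj₁ i≤j rewrite m≤n⇒∣m-n∣≡n∸m i≤j =
    +≡⇒Differ (m+[n∸m]≡n i≤j) (≤-trans (m∸n≤m j i) (<⇒≤ j<v))
  ... | inj₂ j≤i rewrite ∣-∣-comm i j | m≤n⇒∣m-n∣≡n∸m j≤i =
    Product.map Differ-sym Differ-sym (+≡⇒Differ (m+[n∸m]≡n j≤i) (≤-trans (m∸n≤m i j) (<⇒≤ i<v)))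

  edgeLength-Differ : i < v → j < v → Differ (edgeLength v i j) i j
  edgeLength-Differ {i} {j} i<v j<v with ⊓-sel ∣ i - j ∣ (v ∸ ∣ i - j ∣)
  ... | inj₁ eq rewrite eq = proj₁ (distance-Differ i<v j<v)
  ... | inj₂ eq rewrite eq = proj₂ (distance-Differ i<v j<v)

  edgeLength-double≤ : ∀ i j → edgeLength v i j + edgeLength v i j ≤ v
  edgeLength-double≤ i j with ≤-total ∣ i - j ∣ v
  ... | inj₁ δ≤v = ≤-trans (+-mono-≤ (m⊓n≤m δ (v ∸ δ)) (m⊓n≤n δ (v ∸ δ))) (≤-reflexive (m+[n∸m]≡n δ≤v))
    where δ = ∣ i - j ∣
  ... | inj₂ v≤δ rewrite m≤n⇒m∸n≡0 v≤δ | ⊓-zeroʳ ∣ i - j ∣ = z≤n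

  -- ℓ t = min(t mod v, v − t mod v) is the length of every edge {i, j} with j ≡ i ± t.
  ℓ : ℕ → ℕ
  ℓ t = edgeLength v (t % v) 0

  ℓ-Differ : ∀ t → Differ (ℓ t) t 0
  ℓ-Differ t = Differ-resp-≈ (%-≈ t) ≈-refl (edgeLength-Differ (m%n<n t v) (s≤s z≤n))

  ℓ-double≤ : ∀ t → ℓ t + ℓ t ≤ v
  ℓ-double≤ t = edgeLength-double≤ (t % v) 0

  ℓ-small : d + d ≤ v → ℓ d ≡ d
  ℓ-small {d} dd = Differ-unique (ℓ-double≤ d) dd (ℓ-Differ d) (inj₂ ≈-refl)

  Differ-ℓ : Differ d i j → Differ (ℓ d) i j
  Differ-ℓ {d} p = Differ-resp-± p (ℓ-Differ d)

  ∣-resp-≈ : ∀ {k} → k ∣ v → a ≈ b → k ∣ a → k ∣ b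
  ∣-resp-≈ {k = k} k∣v (mk≈ a≈b) k∣a = ∣n∣m%n⇒∣m k∣v (subst (k ∣_) a≈b (%-presˡ-∣ k∣a k∣v))

  ∣-Differ : ∀ {k} → k ∣ v → Differ d t 0 → k ∣ d → k ∣ t
  ∣-Differ {d} {t} {k} k∣v (inj₁ t+d≈0) k∣d =
    ∣m+n∣m⇒∣n (∣-resp-≈ k∣v (≈-sym (≈-trans (≈-reflexive (+-comm d t)) t+d≈0)) (k ∣0)) k∣d
  ∣-Differ k∣v (inj₂ d≈t) k∣d = ∣-resp-≈ k∣v d≈t k∣d

  *-inverse : ∀ {w} → Coprime v w → ∃ λ u → u * w ≈ 1
  *-inverse {w} v⊥w with coprime-Bézout v⊥w
  ... | Bézout.-+ x y 1+xv≡yw = y , (begin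
    y * w              ≡⟨ 1+xv≡yw ⟨
    1 + x * v          ≈⟨ mk≈ ([m+kn]%n≡m%n 1 x v) ⟩
    1                  ∎)
  ... | Bézout.+- x y 1+yw≡xv = n * y , (begin
    n * y * w                ≡⟨ +-identityʳ _ ⟨
    n * y * w + 0            ≈⟨ +-cong (≈-refl {n * y * w}) (mk≈ (m*n%n≡0 x v)) ⟨
    n * y * w + x * v        ≡⟨ cong (n * y * w +_) 1+yw≡xv ⟨
    n * y * w + (1 + y * w)  ≡⟨ lemma n y w ⟩
    1 + y * w * v            ≈⟨ mk≈ ([m+kn]%n≡m%n 1 (y * w) v) ⟩
    1                        ∎)
    where
      lemma : ∀ n y w → n * y * w + (1 + y * w) ≡ 1 + y * w * suc n
      lemma = solve-∀

  module Scaling {w u : ℕ} (u*w≈1 : u * w ≈ 1) where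

    *-cancelˡ-inverse : ∀ i → u * (w * i) ≈ i
    *-cancelˡ-inverse i = begin
      u * (w * i)  ≡⟨ *-assoc u w i ⟨
      u * w * i    ≈⟨ *-cong u*w≈1 ≈-refl ⟩
      1 * i        ≡⟨ *-identityˡ i ⟩
      i            ∎

    *-cancelʳ-inverse : ∀ i → w * (u * i) ≈ i
    *-cancelʳ-inverse i = begin
      w * (u * i)  ≡⟨ *-assoc w u i ⟨
      w * u * i    ≡⟨ cong (_* i) (*-comm w u) ⟩
      u * w * i    ≈⟨ *-cong u*w≈1 ≈-refl ⟩
      1 * i        ≡⟨ *-identityˡ i ⟩
      i            ∎

    scale : ℕ → ℕ
    scale i = w * i % v

    scale< : ∀ i → scale i < v
    scale< i = m%n<n (w * i) v

    scale-≈ : ∀ i → scale i ≈ w * i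
    scale-≈ i = %-≈ (w * i)

    scale-injective : i < v → j < v → scale i ≡ scale j → i ≡ j
    scale-injective {i} {j} i<v j<v scale-i≡scale-j = ≈⇒≡ i<v j<v (begin
      i            ≈⟨ *-cancelˡ-inverse i ⟨
      u * (w * i)  ≈⟨ *-congˡ u (scale-≈ i) ⟨
      u * scale i  ≡⟨ cong (u *_) scale-i≡scale-j ⟩
      u * scale j  ≈⟨ *-congˡ u (scale-≈ j) ⟩
      u * (w * j)  ≈⟨ *-cancelˡ-inverse j ⟩
      j            ∎)

    scale-surjective : j < v → scale (u * j % v) ≡ j
    scale-surjective {j} j<v = ≈⇒≡ (scale< _) j<v (begin
      scale (u * j % v)  ≈⟨ scale-≈ _ ⟩
      w * (u * j % v)    ≈⟨ *-congˡ w (%-≈ (u * j)) ⟩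
      w * (u * j)        ≈⟨ *-cancelʳ-inverse j ⟩
      j                  ∎)

    scale-upTo : map scale (upTo v) ↭ upTo v
    scale-upTo = ↭-trans (↭-reflexive (map-upTo scale v))
      (∼bag⇒↭ (unique∧set⇒bag scale-unique (upTo⁺ v) (mk⇔ to from)))
      where
        scale-unique = applyUpTo⁺₁ scale v (λ i<j j<v → <⇒≢ i<j ∘ scale-injective (<-trans i<j j<v) j<v)
        to : ∀ {x} → x ∈ applyUpTo scale v → x ∈ upTo v
        to x∈ with i , _ , refl ← ∈-applyUpTo⁻ scale x∈ = ∈-upTo⁺ (scale< i)
        from : ∀ {x} → x ∈ upTo v → x ∈ applyUpTo scale v
        from {x} x∈ = subst (_∈ applyUpTo scale v) (scale-surjective (∈-upTo⁻ x∈)) (∈-applyUpTo⁺ scale (m%n<n (u * x) v))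

    scaleLength : ℕ → ℕ
    scaleLength d = ℓ (w * d)

    unscaleLength : ℕ → ℕ
    unscaleLength z = ℓ (u * z)

    edgeLength-scale : i < v → j < v → edgeLength v (scale i) (scale j) ≡ scaleLength (edgeLength v i j)
    edgeLength-scale {i} {j} i<v j<v =
      Differ-unique (edgeLength-double≤ (scale i) (scale j)) (ℓ-double≤ (w * edgeLength v i j))
        (edgeLength-Differ (scale< i) (scale< j))
        (Differ-resp-≈ (≈-sym (scale-≈ i)) (≈-sym (scale-≈ j)) (Differ-ℓ (Differ-*ˡ w (edgeLength-Differ i<v j<v))))

    edgeLengths-scale : ∀ {p} → All (_< v) p → edgeLengths v (map scale p) ≡ map scaleLength (edgeLengths v p)
    edgeLengths-scale []                     = refl
    edgeLengths-scale (_ ∷ [])               = refl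
    edgeLengths-scale (i<v ∷ j<v ∷ rest<v) =
      cong₂ _∷_ (edgeLength-scale i<v j<v) (edgeLengths-scale (j<v ∷ rest<v))

    RealizableOn-scale : ∀ {M} → RealizableOn v M → RealizableOn v (map scaleLength M)
    RealizableOn-scale {M} (p , p↭upTo , lengths↭M) =
      map scale p ,
      ↭-trans (map⁺ scale p↭upTo) scale-upTo ,
      subst (_↭ map scaleLength M) (sym (edgeLengths-scale p<v)) (map⁺ scaleLength lengths↭M)
      where p<v = All-resp-↭ (↭-sym p↭upTo) (all-upTo v)

    Differ-unscale : ∀ z → Differ (w * unscaleLength z) z 0
    Differ-unscale z = Differ-resp-≈ (*-cancelʳ-inverse z) (≈-reflexive (*-zeroʳ w))
      (Differ-*ˡ w (ℓ-Differ (u * z)))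

    scale-unscale : ∀ {z} → z + z ≤ v → scaleLength (unscaleLength z) ≡ z
    scale-unscale {z} zz = Differ-unique (ℓ-double≤ (w * unscaleLength z)) zz (Differ-ℓ (Differ-unscale z)) (inj₂ ≈-refl)

    scaleLength-1 : w + w ≤ v → scaleLength 1 ≡ w
    scaleLength-1 ww = trans (cong ℓ (*-identityʳ w)) (ℓ-small ww)

    unscaleLength-injective : ∀ {z z′} → z + z ≤ v → z′ + z′ ≤ v → unscaleLength z ≡ unscaleLength z′ → z ≡ z′
    unscaleLength-injective zz z′z′ eq =
      trans (sym (scale-unscale zz)) (trans (cong scaleLength eq) (scale-unscale z′z′))

    unscaleLength-admissible : ∀ {z} → Admissible v z → Admissible v (unscaleLength z)
    unscaleLength-admissible {z} (1≤z , z≤v/2 , gcd≡1) =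
      n≢0⇒n>0 unscale≢0 , double≤⇒≤/2 (ℓ-double≤ (u * z)) , coprime⇒gcd≡1 v⊥unscale
      where
        unscale≢0 : unscaleLength z ≢ 0
        unscale≢0 unscale≡0 = <⇒≢ 1≤z (sym (trans (sym (scale-unscale (≤/2⇒double≤ z≤v/2)))
          (trans (cong scaleLength unscale≡0) (cong ℓ (*-zeroʳ w)))))
        v⊥unscale : Coprime v (unscaleLength z)
        v⊥unscale (k∣v , k∣unscale) =
          gcd≡1⇒coprime gcd≡1 (k∣v , ∣-Differ k∣v (Differ-unscale z) (∣n⇒∣m*n w k∣unscale))

    1<unscaleLength : ∀ {z} → w + w ≤ v → Admissible v z → z ≢ w → 1 < unscaleLength z
    1<unscaleLength {z} w+w≤v adm-z z≢w = ≤∧≢⇒< (proj₁ (unscaleLength-admissible adm-z)) λ 1≡unscale →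
      z≢w (trans (sym (scale-unscale (≤/2⇒double≤ (proj₁ (proj₂ adm-z)))))
                 (trans (cong scaleLength (sym 1≡unscale)) (scaleLength-1 w+w≤v)))

length-ms3 : ∀ x a y b z c → length (ms3 x a y b z c) ≡ a + (b + c)
length-ms3 x a y b z c =
  trans (length-++ (replicate a x)) (cong₂ _+_ (length-replicate a)
    (trans (length-++ (replicate b y)) (cong₂ _+_ (length-replicate b) (length-replicate c))))

map-ms3 : ∀ {f : ℕ → ℕ} {x′ y′ z′} x a y b z c → f x ≡ x′ → f y ≡ y′ → f z ≡ z′ →
          map f (ms3 x a y b z c) ≡ ms3 x′ a y′ b z′ c
map-ms3 {f = f} x a y b z c refl refl refl =
  trans (map-++ f (replicate a x) _) (cong₂ _++_ (map-replicate f a x)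
    (trans (map-++ f (replicate b y) _) (cong₂ _++_ (map-replicate f b y) (map-replicate f c z))))

All-ms3 : ∀ {P : ℕ → Set} {x y z} a b c → P x → P y → P z → All P (ms3 x a y b z c)
All-ms3 a b c px py pz = ++⁺ (replicate⁺ a px) (++⁺ (replicate⁺ b py) (replicate⁺ c pz))

ms3-swap₁₂ : ∀ x a y b z c → ms3 x a y b z c ↭ ms3 y b x a z c
ms3-swap₁₂ x a y b z c = shifts (replicate a x) (replicate b y)

ms3-swap₂₃ : ∀ x a y b z c → ms3 x a y b z c ↭ ms3 x a z c y b
ms3-swap₂₃ x a y b z c = ++⁺ˡ (replicate a x) (++-comm (replicate b y) (replicate c z))

ms3-cons₂ : ∀ x a y b z c → y ∷ ms3 x a y b z c ↭ ms3 x a y (suc b) z c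
ms3-cons₂ x a y b z c = ↭-sym (shift y (replicate a x) (replicate b y ++ replicate c z))

ms3-cons₃ : ∀ x a y b z c → z ∷ ms3 x a y b z c ↭ ms3 x a y b z (suc c)
ms3-cons₃ x a y b z c = ↭-trans (↭-sym (shift z (replicate a x) _))
  (++⁺ˡ (replicate a x) (↭-sym (shift z (replicate b y) (replicate c z))))

ms3-decompose : ∀ {x y z L} → All (_∈ x ∷ y ∷ z ∷ []) L → ∃ λ a → ∃₂ λ b c → L ↭ ms3 x a y b z c
ms3-decompose [] = 0 , 0 , 0 , ↭-refl
ms3-decompose (here refl ∷ L⊆) with a , b , c , L↭ ← ms3-decompose L⊆ =
  suc a , b , c , prep _ L↭
ms3-decompose {x} {y} {z} (there (here refl) ∷ L⊆) with a , b , c , L↭ ← ms3-decompose L⊆ =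
  a , suc b , c , ↭-trans (prep _ L↭) (ms3-cons₂ x a y b z c)
ms3-decompose {x} {y} {z} (there (there (here refl)) ∷ L⊆) with a , b , c , L↭ ← ms3-decompose L⊆ =
  a , b , suc c , ↭-trans (prep _ L↭) (ms3-cons₃ x a y b z c)

module _ (Q : ℕ → ℕ → ℕ → ℕ → ℕ → ℕ → Set)
         (Q-swap₁₂ : ∀ x a y b z c → Q x a y b z c → Q y b x a z c)
         (Q-swap₂₃ : ∀ x a y b z c → Q x a y b z c → Q x a z c y b) where

  wlog-first-most-frequent : (∀ x a y b z c → b ≤ a → c ≤ a → Q x a y b z c) → ∀ x a y b z c → Q x a y b z c
  wlog-first-most-frequent Q-sorted x a y b z c with ≤-total b a | ≤-total c a | ≤-total c b
  ... | inj₁ b≤a | inj₁ c≤a | _        = Q-sorted x a y b z c b≤a c≤a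
  ... | inj₂ a≤b | _        | inj₁ c≤b = Q-swap₁₂ y b x a z c (Q-sorted y b x a z c a≤b c≤b)
  ... | inj₂ a≤b | _        | inj₂ b≤c =
    Q-swap₂₃ x a z c y b (Q-swap₁₂ z c x a y b (Q-sorted z c x a y b (≤-trans a≤b b≤c) b≤c))
  ... | inj₁ b≤a | inj₂ a≤c | _        =
    Q-swap₂₃ x a z c y b (Q-swap₁₂ z c x a y b (Q-sorted z c x a y b a≤c (≤-trans b≤a a≤c)))

OneXYRealizable : Set
OneXYRealizable = (x y a b c : ℕ) → 1 < x → x < y → y ∸ 1 ≤ a + b →
  StronglyAdmissible (ms3 1 a x b y c) → Realizable (ms3 1 a x b y c)

Realizable⇒RealizableOn : ∀ {L n} → length L ≡ n → Realizable L → RealizableOn (suc n) L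
Realizable⇒RealizableOn refl realizable = realizable

All-Admissible⇒StronglyAdmissible : ∀ {L n} → length L ≡ n → All (Admissible (suc n)) L → StronglyAdmissible L
All-Admissible⇒StronglyAdmissible refl admissible = admissible

RealizableOn-resp-↭ : ∀ {v L L′} → L ↭ L′ → RealizableOn v L → RealizableOn v L′
RealizableOn-resp-↭ L↭L′ (p , hamiltonian , lengths↭L) = p , hamiltonian , ↭-trans lengths↭L L↭L′

module Reduction (H : OneXYRealizable) (n : ℕ) where
  open Modular n

  realizable-1xy-sorted : ∀ {x y} a b c → 1 < x → x < y → c ≤ a → length (ms3 1 a x b y c) ≡ n →
                   Admissible v x → Admissible v y → RealizableOn v (ms3 1 a x b y c)
  realizable-1xy-sorted {x} {y} a b c 1<x x<y c≤a len adm-x adm-y =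
    Realizable⇒RealizableOn len (H x y a b c 1<x x<y (y∸1≤a+b {a} {b} {c} {y} c≤a y+y≤v)
      (All-Admissible⇒StronglyAdmissible len (All-ms3 a b c adm-1 adm-x adm-y)))
    where
      adm-1 = Admissible-1 {v} (≤-trans (<⇒≤ 1<x) (proj₁ (proj₂ adm-x)))
      y+y≤v : y + y ≤ suc (a + (b + c))
      y+y≤v = subst (λ k → y + y ≤ suc k) (trans (sym len) (length-ms3 1 a x b y c))
                (≤/2⇒double≤ (proj₁ (proj₂ adm-y)))

  realizable-1xy : ∀ {x y} a b c → 1 < x → 1 < y → x ≢ y → b ≤ a → c ≤ a → length (ms3 1 a x b y c) ≡ n →
                 Admissible v x → Admissible v y → RealizableOn v (ms3 1 a x b y c)
  realizable-1xy {x} {y} a b c 1<x 1<y x≢y b≤a c≤a len adm-x adm-y with <-cmp x y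
  ... | tri< x<y _ _ = realizable-1xy-sorted a b c 1<x x<y c≤a len adm-x adm-y
  ... | tri≈ _ x≡y _ = contradiction x≡y x≢y
  ... | tri> _ _ y<x = RealizableOn-resp-↭ (↭-sym swap₂₃)
          (realizable-1xy-sorted a c b 1<y y<x b≤a (trans (sym (↭-length swap₂₃)) len) adm-y adm-x)
    where swap₂₃ = ms3-swap₂₃ 1 a x b y c

  Realizable₃ : ℕ → ℕ → ℕ → ℕ → ℕ → ℕ → Set
  Realizable₃ x a y b z c = x ≢ y → x ≢ z → y ≢ z → Admissible v x → Admissible v y → Admissible v z →
                            length (ms3 x a y b z c) ≡ n → RealizableOn v (ms3 x a y b z c)

  Realizable₃-swap₁₂ : ∀ x a y b z c → Realizable₃ x a y b z c → Realizable₃ y b x a z c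
  Realizable₃-swap₁₂ x a y b z c R y≢x y≢z x≢z adm-y adm-x adm-z len =
    RealizableOn-resp-↭ swap₁₂ (R (≢-sym y≢x) x≢z y≢z adm-x adm-y adm-z (trans (↭-length swap₁₂) len))
    where swap₁₂ = ms3-swap₁₂ x a y b z c

  Realizable₃-swap₂₃ : ∀ x a y b z c → Realizable₃ x a y b z c → Realizable₃ x a z c y b
  Realizable₃-swap₂₃ x a y b z c R x≢z x≢y z≢y adm-x adm-z adm-y len =
    RealizableOn-resp-↭ swap₂₃ (R x≢y x≢z (≢-sym z≢y) adm-x adm-y adm-z (trans (↭-length swap₂₃) len))
    where swap₂₃ = ms3-swap₂₃ x a y b z c

  module _ {w u : ℕ} (u*w≈1 : u * w ≈ 1) where
    open Scaling {w} {u} u*w≈1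

    realizable-scaled : ∀ y z a b c → b ≤ a → c ≤ a → Realizable₃ w a y b z c
    realizable-scaled y z a b c b≤a c≤a w≢y w≢z y≢z adm-w adm-y adm-z len =
      subst (RealizableOn v) (map-ms3 1 a y′ b z′ c (scaleLength-1 w+w≤v) (scale-unscale y+y≤v) (scale-unscale z+z≤v))
        (RealizableOn-scale (realizable-1xy a b c
          (1<unscaleLength w+w≤v adm-y (≢-sym w≢y)) (1<unscaleLength w+w≤v adm-z (≢-sym w≢z))
          (y≢z ∘ unscaleLength-injective y+y≤v z+z≤v) b≤a c≤a
          (trans (length-ms3 1 a y′ b z′ c) (trans (sym (length-ms3 w a y b z c)) len))
          (unscaleLength-admissible adm-y) (unscaleLength-admissible adm-z)))
      where
        y′ = unscaleLength y
        z′ = unscaleLength z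
        w+w≤v = ≤/2⇒double≤ (proj₁ (proj₂ adm-w))
        y+y≤v = ≤/2⇒double≤ (proj₁ (proj₂ adm-y))
        z+z≤v = ≤/2⇒double≤ (proj₁ (proj₂ adm-z))

  realizable-dominant : ∀ x a y b z c → b ≤ a → c ≤ a → Realizable₃ x a y b z c
  realizable-dominant x a y b z c b≤a c≤a x≢y x≢z y≢z adm-x@(_ , _ , gcd[v,x]≡1)
    with u , u*x≈1 ← *-inverse (gcd≡1⇒coprime gcd[v,x]≡1) =
    realizable-scaled {x} {u} u*x≈1 y z a b c b≤a c≤a x≢y x≢z y≢z adm-x

  realizable₃ : ∀ x a y b z c → Realizable₃ x a y b z c
  realizable₃ = wlog-first-most-frequent Realizable₃ Realizable₃-swap₁₂ Realizable₃-swap₂₃ realizable-dominant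

realizable-three-values : OneXYRealizable → ∀ L → StronglyAdmissible L →
  ∀ S → Unique S → length S ≡ 3 → (∀ {x} → x ∈ L → x ∈ S) → (∀ {x} → x ∈ S → x ∈ L) → Realizable L
realizable-three-values H L SA (x ∷ y ∷ z ∷ []) ((x≢y ∷ x≢z ∷ []) ∷ (y≢z ∷ []) ∷ _) _ L⊆S S⊆L
  with a , b , c , L↭ ← ms3-decompose (tabulate L⊆S) =
  RealizableOn-resp-↭ (↭-sym L↭)
    (realizable₃ x a y b z c x≢y x≢z y≢z (admissible (here refl)) (admissible (there (here refl)))
      (admissible (there (there (here refl)))) (sym (↭-length L↭)))
  where
    open Reduction H (length L)
    admissible : ∀ {t} → t ∈ x ∷ y ∷ z ∷ [] → Admissible (suc (length L)) t
    admissible = lookup SA ∘ S⊆L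

theorem2p7 : ((x y a b c : ℕ) → 1 < x → x < y → y ∸ 1 ≤ a + b →
      StronglyAdmissible (ms3 1 a x b y c) → Realizable (ms3 1 a x b y c)) →
    (L : List ℕ) → StronglyAdmissible L → length (supp L) ≡ 3 → Realizable L
theorem2p7 H L SA |supp|≡3 =
  realizable-three-values H L SA (supp L) (deduplicate-! L) |supp|≡3 (∈-deduplicate⁺ _≟_) (∈-deduplicate⁻ _≟_ L)
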